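{- Let $G=(V,E)$ be a simple graph with no isolated vertices and let $k\ge3$. Let $V_{ind}=\{v_{ind}: v\in V\}$ be a set of new vertices, and let $\bar G$ be the graph with vertex set $V\cup V_{ind}\cup L\cup R$ and edges: all of $E$; the edges $u v_{ind}$ and $v u_{ind}$ for every $uv\in E$; for every $v_{ind}\in V_{ind}$, edges to $\deg_G(v)+3$ distinct vertices of $L$ (chosen by Round-Robin over $L$); and the edges of a bipartite $d$-regular graph $X$ with sides $L$ and $R$, where $L,R$ are new vertex sets of equal size $N\ge n+2$ and $d\ge3$. If $c_k$ denotes the number of $k$-cliques in $G$, then the number of $k$-cliques in $\bar G$ is $(k+1)c_k$.
   Context: A $k$-clique is a set of $k$ pairwise adjacent vertices. $V_{ind}$ is an independent set in $\bar G$ (no edges among its vertices). Round-Robin over $L$ means that the neighbors assigned to successive vertices are consecutive vertices of $L$ in a fixed cyclic order. -}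

module Defs where

open import Data.Bool using (Bool; true; false; if_then_else_; _∧_; _∨_)
open import Data.Nat using (ℕ; zero; suc; _+_; _∸_; _<ᵇ_; _≤_)
open import Data.Nat.DivMod using (_%_)
open import Data.Fin using (Fin; toℕ)
open import Data.List using (List; []; _∷_; _++_; map; allFin)
open import Data.Nat.ListAction using (sum)
open import Data.Sum using (_⊎_; inj₁; inj₂)
open import Relation.Binary.PropositionalEquality using (_≡_)

record SimpleGraph (n : ℕ) : Set where
  field
    adj    : Fin n → Fin n → Bool
    sym    : ∀ u v → adj u v ≡ adj v u
    irrefl : ∀ v → adj v v ≡ false
open SimpleGraph public

countB : {A : Set} → (A → Bool) → List A → ℕ
countB p xs = sum (map (λ x → if p x then 1 else 0) xs)

degree : {n : ℕ} → SimpleGraph n → Fin n → ℕ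
degree {n} G v = countB (adj G v) (allFin n)

NoIsolatedVertices : {n : ℕ} → SimpleGraph n → Set
NoIsolatedVertices {n} G = ∀ v → 1 ≤ degree G v

choose : {A : Set} → ℕ → List A → List (List A)
choose zero    _        = [] ∷ []
choose (suc k) []       = []
choose (suc k) (x ∷ xs) = map (x ∷_) (choose k xs) ++ choose (suc k) xs

allB : {A : Set} → (A → Bool) → List A → Bool
allB p []       = true
allB p (x ∷ xs) = p x ∧ allB p xs

pairwiseAdj : {A : Set} → (A → A → Bool) → List A → Bool
pairwiseAdj a []       = true
pairwiseAdj a (x ∷ xs) = allB (a x) xs ∧ pairwiseAdj a xs

-- number of k-cliques of the graph with adjacency `a` on the vertex set
-- enumerated (without repetition) by `vs`: k-subsets that are pairwise adjacent
cliqueCount : {A : Set} → (A → A → Bool) → List A → ℕ → ℕ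
cliqueCount a vs k = countB (pairwiseAdj a) (choose k vs)

-- X : Fin N → Fin N → Bool is the bipartite graph between L = Fin N and R = Fin N
-- (X l r = true iff l r is an edge); it is d-regular.
BipartiteRegular : (N d : ℕ) → (Fin N → Fin N → Bool) → Set
BipartiteRegular N d X =
  (∀ l → countB (X l) (allFin N) ≡ d) × (∀ r → countB (λ l → X l r) (allFin N) ≡ d)
  where open import Data.Product using (_×_)

-- residue modulo N (N = 0 never occurs in the statement since N ≥ n + 2)
modN : ℕ → ℕ → ℕ
modN zero    m = m
modN (suc N) m = m % suc N

-- Round-Robin: vertices v = 0,1,…,n-1 are processed in order; v_ind receives the
-- deg(v)+3 consecutive vertices of L (cyclic order 0,1,…,N-1,0,…) starting right
-- after those used by the previous vertex.
rrOffset : {n : ℕ} → SimpleGraph n → Fin n → ℕ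
rrOffset {n} G v = sum (map (λ u → if toℕ u <ᵇ toℕ v then degree G u + 3 else 0) (allFin n))

rrAdj : {n : ℕ} → SimpleGraph n → (N : ℕ) → Fin n → Fin N → Bool
rrAdj G N v l = modN N (toℕ l + N ∸ modN N (rrOffset G v)) <ᵇ (degree G v + 3)

-- Vertex set of Ḡ: V ⊎ V_ind ⊎ L ⊎ R
BarV : ℕ → ℕ → Set
BarV n N = Fin n ⊎ (Fin n ⊎ (Fin N ⊎ Fin N))

barVerts : (n N : ℕ) → List (BarV n N)
barVerts n N =
  map inj₁ (allFin n) ++ map (λ v → inj₂ (inj₁ v)) (allFin n)
  ++ map (λ l → inj₂ (inj₂ (inj₁ l))) (allFin N) ++ map (λ r → inj₂ (inj₂ (inj₂ r))) (allFin N)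

barAdj : {n : ℕ} → SimpleGraph n → (N : ℕ) → (Fin N → Fin N → Bool) → BarV n N → BarV n N → Bool
barAdj G N X (inj₁ u)                 (inj₁ v)                 = adj G u v
barAdj G N X (inj₁ u)                 (inj₂ (inj₁ v))          = adj G u v
barAdj G N X (inj₂ (inj₁ v))          (inj₁ u)                 = adj G v u
barAdj G N X (inj₂ (inj₁ v))          (inj₂ (inj₂ (inj₁ l)))   = rrAdj G N v l
barAdj G N X (inj₂ (inj₂ (inj₁ l)))   (inj₂ (inj₁ v))          = rrAdj G N v l
barAdj G N X (inj₂ (inj₂ (inj₁ l)))   (inj₂ (inj₂ (inj₂ r)))   = X l r
barAdj G N X (inj₂ (inj₂ (inj₂ r)))   (inj₂ (inj₂ (inj₁ l)))   = X l r
barAdj G N X _                        _                        = false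

-- Every triangle of Ḡ lies in V ∪ V_ind: the neighbours of a vertex of L lie in V_ind ∪ R, those of a
-- vertex of R lie in L, and both sets are independent. So for k ≥ 3 the k-cliques of Ḡ are those of the
-- splitting graph of G, in which each vertex v gets a twin v_ind joined to the neighbours of v. Twins are
-- pairwise non-adjacent, so a k-clique of the splitting graph is either a k-clique of G or a twin v_ind
-- together with a (k-1)-clique inside the neighbourhood of v; summing the latter over v counts every
-- k-clique of G once for each of its k vertices.
module Submission where

open import Data.Bool using (Bool; true; false; if_then_else_; _∧_; T; T?)
open import Data.Bool.Properties using (∧-conicalˡ; ∧-conicalʳ; ∧-zeroʳ)
open import Data.Fin using (Fin)
open import Data.List using (List; []; _∷_; _++_; map; allFin; length; filterᵇ)
open import Data.List.Properties
  using (map-++; map-∘; map-cong; length-map; length-++; ++-identityʳ; filter-++; filter-reject; filter-none; filter-all)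
open import Data.List.Relation.Unary.All using (universal)
open import Data.List.Relation.Unary.All.Properties using (map⁺)
open import Data.Nat using (ℕ; zero; suc; _+_; _*_; _≤_; s≤s)
open import Data.Nat.ListAction using (sum)
open import Data.Nat.ListAction.Properties using (sum-++)
open import Data.Nat.Properties using (+-comm; +-assoc; *-distribˡ-+; *-identityˡ; *-zeroʳ; +-commutativeSemigroup)
open import Algebra.Properties.CommutativeSemigroup +-commutativeSemigroup using (interchange; x∙yz≈y∙xz)
open import Data.Sum using (_⊎_; inj₁; inj₂)
open import Data.Unit using (tt)
open import Function using (_∘_)
open import Relation.Binary.PropositionalEquality
  using (_≡_; refl; sym; trans; cong; cong₂; subst; module ≡-Reasoning)
open import Relation.Nullary using (¬_)
open import Relation.Unary using (Decidable)

open import Defs renaming (sym to adj-sym; irrefl to adj-irrefl)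

open ≡-Reasoning

private
  variable
    A B : Set

filterᵇ-map : (p : B → Bool) (f : A → B) (xs : List A) → filterᵇ p (map f xs) ≡ map f (filterᵇ (p ∘ f) xs)
filterᵇ-map p f []       = refl
filterᵇ-map p f (x ∷ xs) with p (f x)
... | true  = cong (f x ∷_) (filterᵇ-map p f xs)
... | false = filterᵇ-map p f xs

filterᵇ-comm : (p q : A → Bool) (xs : List A) → filterᵇ p (filterᵇ q xs) ≡ filterᵇ q (filterᵇ p xs)
filterᵇ-comm p q []       = refl
filterᵇ-comm p q (x ∷ xs) with p x in px | q x in qx
... | true  | true  rewrite px | qx = cong (x ∷_) (filterᵇ-comm p q xs)
... | true  | false rewrite qx = filterᵇ-comm p q xs
... | false | true  rewrite px = filterᵇ-comm p q xs
... | false | false = filterᵇ-comm p q xs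

choose-map : (f : A → B) (k : ℕ) (xs : List A) → choose k (map f xs) ≡ map (map f) (choose k xs)
choose-map f zero    xs       = refl
choose-map f (suc k) []       = refl
choose-map f (suc k) (x ∷ xs) = begin
  map (f x ∷_) (choose k (map f xs)) ++ choose (suc k) (map f xs)
    ≡⟨ cong₂ (λ ys zs → map (f x ∷_) ys ++ zs) (choose-map f k xs) (choose-map f (suc k) xs) ⟩
  map (f x ∷_) (map (map f) (choose k xs)) ++ map (map f) (choose (suc k) xs)
    ≡⟨ cong (_++ _) (trans (sym (map-∘ (choose k xs))) (map-∘ (choose k xs))) ⟩
  map (map f) (map (x ∷_) (choose k xs)) ++ map (map f) (choose (suc k) xs)
    ≡⟨ map-++ (map f) (map (x ∷_) (choose k xs)) _ ⟨
  map (map f) (map (x ∷_) (choose k xs) ++ choose (suc k) xs)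
    ∎

countB-++ : (p : A → Bool) (xs ys : List A) → countB p (xs ++ ys) ≡ countB p xs + countB p ys
countB-++ p xs ys = trans (cong sum (map-++ _ xs ys)) (sum-++ (map _ xs) _)

countB-map : (p : B → Bool) (f : A → B) (xs : List A) → countB p (map f xs) ≡ countB (p ∘ f) xs
countB-map p f xs = cong sum (sym (map-∘ xs))

countB-cong : {p q : A → Bool} → (∀ x → p x ≡ q x) → (xs : List A) → countB p xs ≡ countB q xs
countB-cong p≗q xs = cong sum (map-cong (λ x → cong (if_then 1 else 0) (p≗q x)) xs)

countB-false : (xs : List A) → countB (λ _ → false) xs ≡ 0
countB-false []       = refl
countB-false (_ ∷ xs) = countB-false xs

countB-choose-∷ : (p : List A → Bool) (k : ℕ) (x : A) (xs : List A) →
  countB p (choose (suc k) (x ∷ xs)) ≡ countB (p ∘ (x ∷_)) (choose k xs) + countB p (choose (suc k) xs)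
countB-choose-∷ p k x xs = begin
  countB p (map (x ∷_) (choose k xs) ++ choose (suc k) xs)             ≡⟨ countB-++ p (map (x ∷_) (choose k xs)) _ ⟩
  countB p (map (x ∷_) (choose k xs)) + countB p (choose (suc k) xs)   ≡⟨ cong (_+ _) (countB-map p (x ∷_) (choose k xs)) ⟩
  countB (p ∘ (x ∷_)) (choose k xs) + countB p (choose (suc k) xs)     ∎

countB-choose-cong : {p q : List A → Bool} (k : ℕ) →
  (∀ s → length s ≡ k → p s ≡ q s) → (xs : List A) → countB p (choose k xs) ≡ countB q (choose k xs)
countB-choose-cong zero    p≗q xs       = cong (λ b → (if b then 1 else 0) + 0) (p≗q [] refl)
countB-choose-cong (suc k) p≗q []       = refl
countB-choose-cong {p = p} {q} (suc k) p≗q (x ∷ xs) = begin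
  countB p (choose (suc k) (x ∷ xs))                                   ≡⟨ countB-choose-∷ p k x xs ⟩
  countB (p ∘ (x ∷_)) (choose k xs) + countB p (choose (suc k) xs)     ≡⟨ cong₂ _+_
       (countB-choose-cong k (λ s ∣s∣≡k → p≗q (x ∷ s) (cong suc ∣s∣≡k)) xs)
       (countB-choose-cong (suc k) p≗q xs) ⟩
  countB (q ∘ (x ∷_)) (choose k xs) + countB q (choose (suc k) xs)     ≡⟨ countB-choose-∷ q k x xs ⟨
  countB q (choose (suc k) (x ∷ xs))                                   ∎

countB-choose-filterᵇ : (q : A → Bool) (p : List A → Bool) (k : ℕ) (xs : List A) →
  countB (λ s → allB q s ∧ p s) (choose k xs) ≡ countB p (choose k (filterᵇ q xs))
countB-choose-filterᵇ q p zero    xs       = refl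
countB-choose-filterᵇ q p (suc k) []       = refl
countB-choose-filterᵇ q p (suc k) (x ∷ xs) with q x in qx
... | true = begin
  countB (λ s → allB q s ∧ p s) (choose (suc k) (x ∷ xs))
    ≡⟨ countB-choose-∷ _ k x xs ⟩
  countB (λ s → (q x ∧ allB q s) ∧ p (x ∷ s)) (choose k xs) + countB (λ s → allB q s ∧ p s) (choose (suc k) xs)
    ≡⟨ cong₂ _+_ (trans (countB-cong (λ s → cong (λ b → (b ∧ allB q s) ∧ p (x ∷ s)) qx) (choose k xs))
                        (countB-choose-filterᵇ q (p ∘ (x ∷_)) k xs))
                 (countB-choose-filterᵇ q p (suc k) xs) ⟩
  countB (p ∘ (x ∷_)) (choose k (filterᵇ q xs)) + countB p (choose (suc k) (filterᵇ q xs))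
    ≡⟨ countB-choose-∷ p k x (filterᵇ q xs) ⟨
  countB p (choose (suc k) (x ∷ filterᵇ q xs))
    ∎
... | false = begin
  countB (λ s → allB q s ∧ p s) (choose (suc k) (x ∷ xs))
    ≡⟨ countB-choose-∷ _ k x xs ⟩
  countB (λ s → (q x ∧ allB q s) ∧ p (x ∷ s)) (choose k xs) + countB (λ s → allB q s ∧ p s) (choose (suc k) xs)
    ≡⟨ cong₂ _+_ (trans (countB-cong (λ s → cong (λ b → (b ∧ allB q s) ∧ p (x ∷ s)) qx) (choose k xs))
                        (countB-false (choose k xs)))
                 (countB-choose-filterᵇ q p (suc k) xs) ⟩
  countB p (choose (suc k) (filterᵇ q xs))
    ∎

module _ {a : B → B → Bool} {b : A → A → Bool} {f : A → B} (b≗a∘f : ∀ x y → b x y ≡ a (f x) (f y)) where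

  allB-map : ∀ x s → allB (a (f x)) (map f s) ≡ allB (b x) s
  allB-map x []      = refl
  allB-map x (y ∷ s) = cong₂ _∧_ (sym (b≗a∘f x y)) (allB-map x s)

  pairwiseAdj-map : ∀ s → pairwiseAdj a (map f s) ≡ pairwiseAdj b s
  pairwiseAdj-map []      = refl
  pairwiseAdj-map (x ∷ s) = cong₂ _∧_ (allB-map x s) (pairwiseAdj-map s)

  cliqueCount-map : ∀ vs k → cliqueCount a (map f vs) k ≡ cliqueCount b vs k
  cliqueCount-map vs k = begin
    countB (pairwiseAdj a) (choose k (map f vs))        ≡⟨ cong (countB _) (choose-map f k vs) ⟩
    countB (pairwiseAdj a) (map (map f) (choose k vs))  ≡⟨ countB-map _ (map f) (choose k vs) ⟩
    countB (pairwiseAdj a ∘ map f) (choose k vs)        ≡⟨ countB-cong pairwiseAdj-map (choose k vs) ⟩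
    countB (pairwiseAdj b) (choose k vs)                ∎

cliqueCount-∷ : (a : A → A → Bool) (x : A) (xs : List A) (k : ℕ) →
  cliqueCount a (x ∷ xs) (suc k) ≡ cliqueCount a (filterᵇ (a x) xs) k + cliqueCount a xs (suc k)
cliqueCount-∷ a x xs k = begin
  cliqueCount a (x ∷ xs) (suc k)
    ≡⟨ countB-choose-∷ (pairwiseAdj a) k x xs ⟩
  countB (λ s → allB (a x) s ∧ pairwiseAdj a s) (choose k xs) + cliqueCount a xs (suc k)
    ≡⟨ cong (_+ _) (countB-choose-filterᵇ (a x) (pairwiseAdj a) k xs) ⟩
  cliqueCount a (filterᵇ (a x) xs) k + cliqueCount a xs (suc k)
    ∎

cliqueCount-one : (a : A → A → Bool) (xs : List A) → cliqueCount a xs 1 ≡ length xs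
cliqueCount-one a []       = refl
cliqueCount-one a (x ∷ xs) = cong suc (cliqueCount-one a xs)

cliqueCount-filterᵇ : (a : A → A → Bool) (q : A → Bool) (k : ℕ) →
  (∀ s → length s ≡ k → pairwiseAdj a s ≡ true → allB q s ≡ true) →
  (vs : List A) → cliqueCount a vs k ≡ cliqueCount a (filterᵇ q vs) k
cliqueCount-filterᵇ a q k clique⇒q vs = begin
  countB (pairwiseAdj a) (choose k vs)                          ≡⟨ countB-choose-cong k pw≡q∧pw vs ⟩
  countB (λ s → allB q s ∧ pairwiseAdj a s) (choose k vs)      ≡⟨ countB-choose-filterᵇ q (pairwiseAdj a) k vs ⟩
  countB (pairwiseAdj a) (choose k (filterᵇ q vs))              ∎
  where
  pw≡q∧pw : ∀ s → length s ≡ k → pairwiseAdj a s ≡ allB q s ∧ pairwiseAdj a s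
  pw≡q∧pw s ∣s∣≡k with pairwiseAdj a s in pw
  ... | true  = sym (cong (_∧ true) (clique⇒q s ∣s∣≡k pw))
  ... | false = sym (∧-zeroʳ (allB q s))

module _ {a : A → A → Bool} (a-sym : ∀ x y → a x y ≡ a y x) {q : A → Bool}
         (triangle⇒q : ∀ {x y z} → a x y ≡ true → a x z ≡ true → a y z ≡ true → q x ≡ true) where

  private
    a-sym-true : ∀ {x y} → a x y ≡ true → a y x ≡ true
    a-sym-true {x} {y} xy = trans (a-sym y x) xy

  allB-common-neighbours : ∀ {x y} → a x y ≡ true →
    ∀ r → allB (a x) r ≡ true → allB (a y) r ≡ true → allB q r ≡ true
  allB-common-neighbours xy []      _    _    = refl
  allB-common-neighbours xy (w ∷ r) xwr ywr = cong₂ _∧_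
    (triangle⇒q (a-sym-true (∧-conicalˡ _ _ xwr)) (a-sym-true (∧-conicalˡ _ _ ywr)) xy)
    (allB-common-neighbours xy r (∧-conicalʳ _ _ xwr) (∧-conicalʳ _ _ ywr))

  allB-large-clique : ∀ s → 3 ≤ length s → pairwiseAdj a s ≡ true → allB q s ≡ true
  allB-large-clique (_ ∷ [])     (s≤s ())        _
  allB-large-clique (_ ∷ _ ∷ []) (s≤s (s≤s ())) _
  allB-large-clique (x ∷ y ∷ z ∷ r) _ pw = cong₂ _∧_ (triangle⇒q xy xz yz)
    (cong₂ _∧_ (triangle⇒q (a-sym-true xy) yz xz)
    (cong₂ _∧_ (triangle⇒q (a-sym-true xz) (a-sym-true yz) xy)
    (allB-common-neighbours xy r xr yr)))
    where
    x∼yzr : allB (a x) (y ∷ z ∷ r) ≡ true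
    y∼zr  : allB (a y) (z ∷ r) ≡ true
    xy    : a x y ≡ true
    xz    : a x z ≡ true
    yz    : a y z ≡ true
    xr    : allB (a x) r ≡ true
    yr    : allB (a y) r ≡ true
    x∼yzr = ∧-conicalˡ (allB (a x) (y ∷ z ∷ r)) _ pw
    y∼zr  = ∧-conicalˡ (allB (a y) (z ∷ r)) _ (∧-conicalʳ (allB (a x) (y ∷ z ∷ r)) _ pw)
    xy    = ∧-conicalˡ (a x y) _ x∼yzr
    xz    = ∧-conicalˡ (a x z) _ (∧-conicalʳ (a x y) _ x∼yzr)
    xr    = ∧-conicalʳ (a x z) _ (∧-conicalʳ (a x y) _ x∼yzr)
    yz    = ∧-conicalˡ (a y z) _ y∼zr
    yr    = ∧-conicalʳ (a y z) _ y∼zr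

splitting : (A → A → Bool) → A ⊎ A → A ⊎ A → Bool
splitting a (inj₁ u) (inj₁ v) = a u v
splitting a (inj₁ u) (inj₂ v) = a u v
splitting a (inj₂ u) (inj₁ v) = a u v
splitting a (inj₂ _) (inj₂ _) = false

module Splitting {a : A → A → Bool} (a-sym : ∀ x y → a x y ≡ a y x) (a-irrefl : ∀ x → a x x ≡ false) where

  coneCount : List A → List A → ℕ → ℕ
  coneCount xs ys k = sum (map (λ y → cliqueCount a (filterᵇ (a y) xs) k) ys)

  coneCount-zero : ∀ xs ys → coneCount xs ys 0 ≡ length ys
  coneCount-zero xs []       = refl
  coneCount-zero xs (_ ∷ ys) = cong suc (coneCount-zero xs ys)

  coneCount-∷ : ∀ x xs ys k →
    coneCount (x ∷ xs) ys (suc k) ≡ coneCount (filterᵇ (a x) xs) (filterᵇ (a x) ys) k + coneCount xs ys (suc k)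
  coneCount-∷ x xs []       k = refl
  coneCount-∷ x xs (y ∷ ys) k with a x y | a y x | a-sym x y
  ... | true  | .true  | refl = begin
    cliqueCount a (x ∷ filterᵇ (a y) xs) (suc k) + coneCount (x ∷ xs) ys (suc k)
      ≡⟨ cong₂ _+_ (cliqueCount-∷ a x (filterᵇ (a y) xs) k) (coneCount-∷ x xs ys k) ⟩
    (cliqueCount a (filterᵇ (a x) (filterᵇ (a y) xs)) k + cy) + (cx + rest)
      ≡⟨ interchange (cliqueCount a (filterᵇ (a x) (filterᵇ (a y) xs)) k) cy cx rest ⟩
    (cliqueCount a (filterᵇ (a x) (filterᵇ (a y) xs)) k + cx) + (cy + rest)
      ≡⟨ cong (λ zs → (cliqueCount a zs k + cx) + (cy + rest)) (filterᵇ-comm (a x) (a y) xs) ⟩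
    (cliqueCount a (filterᵇ (a y) (filterᵇ (a x) xs)) k + cx) + (cy + rest)
      ∎
    where
    cy cx rest : ℕ
    cy   = cliqueCount a (filterᵇ (a y) xs) (suc k)
    cx   = coneCount (filterᵇ (a x) xs) (filterᵇ (a x) ys) k
    rest = coneCount xs ys (suc k)
  ... | false | .false | refl = trans (cong (_ +_) (coneCount-∷ x xs ys k)) (x∙yz≈y∙xz
    (cliqueCount a (filterᵇ (a y) xs) (suc k)) (coneCount (filterᵇ (a x) xs) (filterᵇ (a x) ys) k) (coneCount xs ys (suc k)))

  private
    filterᵇ-∷-self : ∀ x xs → filterᵇ (a x) (x ∷ xs) ≡ filterᵇ (a x) xs
    filterᵇ-∷-self x xs = filter-reject (T? ∘ a x) (subst T (a-irrefl x))

  coneCount-self : ∀ k xs → coneCount xs xs k ≡ suc k * cliqueCount a xs (suc k)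
  coneCount-self zero    xs       = begin
    coneCount xs xs 0           ≡⟨ coneCount-zero xs xs ⟩
    length xs                   ≡⟨ cliqueCount-one a xs ⟨
    cliqueCount a xs 1          ≡⟨ *-identityˡ _ ⟨
    1 * cliqueCount a xs 1      ∎
  coneCount-self (suc j) []       = sym (*-zeroʳ (2 + j))
  coneCount-self (suc j) (x ∷ xs) = begin
    coneCount (x ∷ xs) (x ∷ xs) (suc j)
      ≡⟨ coneCount-∷ x xs (x ∷ xs) j ⟩
    coneCount nx (filterᵇ (a x) (x ∷ xs)) j + (cliqueCount a nx (suc j) + coneCount xs xs (suc j))
      ≡⟨ cong₂ (λ zs m → coneCount nx zs j + (cliqueCount a nx (suc j) + m))
               (filterᵇ-∷-self x xs) (coneCount-self (suc j) xs) ⟩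
    coneCount nx nx j + (cliqueCount a nx (suc j) + (2 + j) * cliqueCount a xs (2 + j))
      ≡⟨ cong (_+ (c₁ + (2 + j) * c₂)) (coneCount-self j nx) ⟩
    (1 + j) * c₁ + (c₁ + (2 + j) * c₂)
      ≡⟨ +-assoc ((1 + j) * c₁) c₁ ((2 + j) * c₂) ⟨
    ((1 + j) * c₁ + c₁) + (2 + j) * c₂
      ≡⟨ cong (_+ (2 + j) * c₂) (+-comm ((1 + j) * c₁) c₁) ⟩
    (2 + j) * c₁ + (2 + j) * c₂
      ≡⟨ *-distribˡ-+ (2 + j) c₁ c₂ ⟨
    (2 + j) * (c₁ + c₂)
      ≡⟨ cong ((2 + j) *_) (cliqueCount-∷ a x xs (suc j)) ⟨
    (2 + j) * cliqueCount a (x ∷ xs) (2 + j)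
      ∎
    where
    nx : List A
    nx = filterᵇ (a x) xs
    c₁ c₂ : ℕ
    c₁ = cliqueCount a nx (suc j)
    c₂ = cliqueCount a xs (2 + j)

  filterᵇ-splitting-inj₁ : ∀ x xs ys →
    filterᵇ (splitting a (inj₁ x)) (map inj₁ xs ++ map inj₂ ys) ≡ map inj₁ (filterᵇ (a x) xs) ++ map inj₂ (filterᵇ (a x) ys)
  filterᵇ-splitting-inj₁ x xs ys = trans (filter-++ (T? ∘ splitting a (inj₁ x)) (map inj₁ xs) (map inj₂ ys))
    (cong₂ _++_ (filterᵇ-map (splitting a (inj₁ x)) inj₁ xs) (filterᵇ-map (splitting a (inj₁ x)) inj₂ ys))

  filterᵇ-splitting-inj₂ : ∀ y ys → filterᵇ (splitting a (inj₂ y)) (map inj₂ ys) ≡ []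
  filterᵇ-splitting-inj₂ y ys = trans (filterᵇ-map (splitting a (inj₂ y)) inj₂ ys)
    (cong (map inj₂) (filter-none (T? ∘ λ _ → false) (universal (λ _ ()) ys)))

  splitting-cliqueCount-suc : ∀ k xs ys →
    cliqueCount (splitting a) (map inj₁ xs ++ map inj₂ ys) (suc k) ≡ cliqueCount a xs (suc k) + coneCount xs ys k
  splitting-cliqueCount-suc zero xs ys = begin
    cliqueCount (splitting a) (map inj₁ xs ++ map inj₂ ys) 1
      ≡⟨ cliqueCount-one (splitting a) (map inj₁ xs ++ map inj₂ ys) ⟩
    length (map inj₁ xs ++ map inj₂ ys)
      ≡⟨ length-++ (map inj₁ xs) ⟩
    length (map inj₁ xs) + length (map inj₂ ys)
      ≡⟨ cong₂ _+_ (length-map inj₁ xs) (length-map inj₂ ys) ⟩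
    length xs + length ys
      ≡⟨ cong₂ _+_ (cliqueCount-one a xs) (coneCount-zero xs ys) ⟨
    cliqueCount a xs 1 + coneCount xs ys 0
      ∎
  splitting-cliqueCount-suc (suc j) []       []       = refl
  splitting-cliqueCount-suc (suc j) []       (y ∷ ys) = begin
    cliqueCount (splitting a) (inj₂ y ∷ map inj₂ ys) (2 + j)
      ≡⟨ cliqueCount-∷ (splitting a) (inj₂ y) (map inj₂ ys) (suc j) ⟩
    cliqueCount (splitting a) (filterᵇ (splitting a (inj₂ y)) (map inj₂ ys)) (suc j)
      + cliqueCount (splitting a) (map inj₂ ys) (2 + j)
      ≡⟨ cong₂ _+_ (cong (λ zs → cliqueCount (splitting a) zs (suc j)) (filterᵇ-splitting-inj₂ y ys))
                   (splitting-cliqueCount-suc (suc j) [] ys) ⟩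
    coneCount [] ys (suc j)
      ∎
  splitting-cliqueCount-suc (suc j) (x ∷ xs) ys = begin
    cliqueCount (splitting a) (inj₁ x ∷ map inj₁ xs ++ map inj₂ ys) (2 + j)
      ≡⟨ cliqueCount-∷ (splitting a) (inj₁ x) (map inj₁ xs ++ map inj₂ ys) (suc j) ⟩
    cliqueCount (splitting a) (filterᵇ (splitting a (inj₁ x)) (map inj₁ xs ++ map inj₂ ys)) (suc j)
      + cliqueCount (splitting a) (map inj₁ xs ++ map inj₂ ys) (2 + j)
      ≡⟨ cong (λ zs → cliqueCount (splitting a) zs (suc j) + _) (filterᵇ-splitting-inj₁ x xs ys) ⟩
    cliqueCount (splitting a) (map inj₁ nx ++ map inj₂ ny) (suc j)
      + cliqueCount (splitting a) (map inj₁ xs ++ map inj₂ ys) (2 + j)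
      ≡⟨ cong₂ _+_ (splitting-cliqueCount-suc j nx ny) (splitting-cliqueCount-suc (suc j) xs ys) ⟩
    (cliqueCount a nx (suc j) + coneCount nx ny j) + (cliqueCount a xs (2 + j) + coneCount xs ys (suc j))
      ≡⟨ interchange (cliqueCount a nx (suc j)) (coneCount nx ny j) (cliqueCount a xs (2 + j)) (coneCount xs ys (suc j)) ⟩
    (cliqueCount a nx (suc j) + cliqueCount a xs (2 + j)) + (coneCount nx ny j + coneCount xs ys (suc j))
      ≡⟨ cong₂ _+_ (cliqueCount-∷ a x xs (suc j)) (coneCount-∷ x xs ys j) ⟨
    cliqueCount a (x ∷ xs) (2 + j) + coneCount (x ∷ xs) ys (suc j)
      ∎
    where
    nx ny : List A
    nx = filterᵇ (a x) xs
    ny = filterᵇ (a x) ys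

  splitting-cliqueCount : ∀ k vs → cliqueCount (splitting a) (map inj₁ vs ++ map inj₂ vs) k ≡ (k + 1) * cliqueCount a vs k
  splitting-cliqueCount zero    vs = refl
  splitting-cliqueCount (suc k) vs = begin
    cliqueCount (splitting a) (map inj₁ vs ++ map inj₂ vs) (suc k)
      ≡⟨ splitting-cliqueCount-suc k vs vs ⟩
    c + coneCount vs vs k
      ≡⟨ cong (c +_) (coneCount-self k vs) ⟩
    c + suc k * c
      ≡⟨ cong (λ m → c + m * c) (+-comm 1 k) ⟩
    (suc k + 1) * c
      ∎
    where
    c : ℕ
    c = cliqueCount a vs (suc k)

pattern vert v  = inj₁ v
pattern ind v   = inj₂ (inj₁ v)
pattern left l  = inj₂ (inj₂ (inj₁ l))
pattern right r = inj₂ (inj₂ (inj₂ r))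

module BarGraph {n : ℕ} (G : SimpleGraph n) (N : ℕ) (X : Fin N → Fin N → Bool) where

  private
    ba : BarV n N → BarV n N → Bool
    ba = barAdj G N X

  barAdj-sym : ∀ x y → ba x y ≡ ba y x
  barAdj-sym (vert u)  (vert v)  = adj-sym G u v
  barAdj-sym (vert u)  (ind v)   = adj-sym G u v
  barAdj-sym (vert _)  (left _)  = refl
  barAdj-sym (vert _)  (right _) = refl
  barAdj-sym (ind u)   (vert v)  = adj-sym G u v
  barAdj-sym (ind _)   (ind _)   = refl
  barAdj-sym (ind _)   (left _)  = refl
  barAdj-sym (ind _)   (right _) = refl
  barAdj-sym (left _)  (vert _)  = refl
  barAdj-sym (left _)  (ind _)   = refl
  barAdj-sym (left _)  (left _)  = refl
  barAdj-sym (left _)  (right _) = refl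
  barAdj-sym (right _) (vert _)  = refl
  barAdj-sym (right _) (ind _)   = refl
  barAdj-sym (right _) (left _)  = refl
  barAdj-sym (right _) (right _) = refl

  isCore : BarV n N → Bool
  isCore (vert _)  = true
  isCore (ind _)   = true
  isCore (left _)  = false
  isCore (right _) = false

  triangle⇒isCore : ∀ {x y z} → ba x y ≡ true → ba x z ≡ true → ba y z ≡ true → isCore x ≡ true
  triangle⇒isCore {vert _}                        _  _  _  = refl
  triangle⇒isCore {ind _}                         _  _  _  = refl
  triangle⇒isCore {left _}  {vert _}              () _  _
  triangle⇒isCore {left _}  {left _}              () _  _
  triangle⇒isCore {left _}  {ind _}   {vert _}    _  () _
  triangle⇒isCore {left _}  {ind _}   {left _}    _  () _
  triangle⇒isCore {left _}  {ind _}   {ind _}     _  _  ()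
  triangle⇒isCore {left _}  {ind _}   {right _}   _  _  ()
  triangle⇒isCore {left _}  {right _} {vert _}    _  () _
  triangle⇒isCore {left _}  {right _} {left _}    _  () _
  triangle⇒isCore {left _}  {right _} {ind _}     _  _  ()
  triangle⇒isCore {left _}  {right _} {right _}   _  _  ()
  triangle⇒isCore {right _} {vert _}              () _  _
  triangle⇒isCore {right _} {ind _}               () _  _
  triangle⇒isCore {right _} {right _}             () _  _
  triangle⇒isCore {right _} {left _}  {vert _}    _  () _
  triangle⇒isCore {right _} {left _}  {ind _}     _  () _
  triangle⇒isCore {right _} {left _}  {right _}   _  () _
  triangle⇒isCore {right _} {left _}  {left _}    _  _  ()

  core : Fin n ⊎ Fin n → BarV n N
  core (inj₁ v) = vert v
  core (inj₂ v) = ind v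

  splitting-barAdj-core : ∀ x y → splitting (adj G) x y ≡ ba (core x) (core y)
  splitting-barAdj-core (inj₁ _) (inj₁ _) = refl
  splitting-barAdj-core (inj₁ _) (inj₂ _) = refl
  splitting-barAdj-core (inj₂ _) (inj₁ _) = refl
  splitting-barAdj-core (inj₂ _) (inj₂ _) = refl

  filterᵇ-isCore-barVerts : filterᵇ isCore (barVerts n N) ≡ map core (map inj₁ (allFin n) ++ map inj₂ (allFin n))
  filterᵇ-isCore-barVerts = begin
    filterᵇ isCore (Vs ++ Is ++ Ls ++ Rs)
      ≡⟨ filter-++ isCore? Vs (Is ++ Ls ++ Rs) ⟩
    filterᵇ isCore Vs ++ filterᵇ isCore (Is ++ Ls ++ Rs)
      ≡⟨ cong (filterᵇ isCore Vs ++_) (filter-++ isCore? Is (Ls ++ Rs)) ⟩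
    filterᵇ isCore Vs ++ filterᵇ isCore Is ++ filterᵇ isCore (Ls ++ Rs)
      ≡⟨ cong (λ zs → filterᵇ isCore Vs ++ filterᵇ isCore Is ++ zs) (filter-++ isCore? Ls Rs) ⟩
    filterᵇ isCore Vs ++ filterᵇ isCore Is ++ filterᵇ isCore Ls ++ filterᵇ isCore Rs
      ≡⟨ cong₂ _++_ (kept inj₁ (λ _ → tt)) (cong₂ _++_ (kept (λ v → ind v) (λ _ → tt))
           (cong₂ _++_ (dropped (λ l → left l) (λ _ ())) (dropped (λ r → right r) (λ _ ())))) ⟩
    Vs ++ Is ++ []
      ≡⟨ cong (Vs ++_) (++-identityʳ Is) ⟩
    Vs ++ Is
      ≡⟨ cong₂ _++_ (map-∘ vs) (map-∘ vs) ⟩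
    map core (map inj₁ vs) ++ map core (map inj₂ vs)
      ≡⟨ map-++ core (map inj₁ vs) (map inj₂ vs) ⟨
    map core (map inj₁ vs ++ map inj₂ vs)
      ∎
    where
    vs : List (Fin n)
    ls : List (Fin N)
    Vs Is Ls Rs : List (BarV n N)
    isCore? : Decidable (T ∘ isCore)
    vs = allFin n
    ls = allFin N
    Vs = map inj₁ vs
    Is = map (λ v → ind v) vs
    Ls = map (λ l → left l) ls
    Rs = map (λ r → right r) ls
    isCore? = T? ∘ isCore
    kept : (f : Fin n → BarV n N) → (∀ v → T (isCore (f v))) → filterᵇ isCore (map f vs) ≡ map f vs
    kept f core-f = filter-all isCore? (map⁺ (universal core-f vs))
    dropped : (f : Fin N → BarV n N) → (∀ l → ¬ T (isCore (f l))) → filterᵇ isCore (map f ls) ≡ []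
    dropped f outer-f = filter-none isCore? (map⁺ (universal outer-f ls))

corollary2 : {n : ℕ} (G : SimpleGraph n) → NoIsolatedVertices G →
    (k : ℕ) → 3 ≤ k →
    (N d : ℕ) → n + 2 ≤ N → 3 ≤ d →
    (X : Fin N → Fin N → Bool) → BipartiteRegular N d X →
    cliqueCount (barAdj G N X) (barVerts n N) k ≡ (k + 1) * cliqueCount (adj G) (allFin n) k
corollary2 {n} G _ k 3≤k N _ _ _ X _ = begin
  cliqueCount (barAdj G N X) (barVerts n N) k
    ≡⟨ cliqueCount-filterᵇ (barAdj G N X) isCore k large-clique⇒core (barVerts n N) ⟩
  cliqueCount (barAdj G N X) (filterᵇ isCore (barVerts n N)) k
    ≡⟨ cong (λ zs → cliqueCount (barAdj G N X) zs k) filterᵇ-isCore-barVerts ⟩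
  cliqueCount (barAdj G N X) (map core (map inj₁ vs ++ map inj₂ vs)) k
    ≡⟨ cliqueCount-map splitting-barAdj-core (map inj₁ vs ++ map inj₂ vs) k ⟩
  cliqueCount (splitting (adj G)) (map inj₁ vs ++ map inj₂ vs) k
    ≡⟨ Splitting.splitting-cliqueCount (adj-sym G) (adj-irrefl G) k vs ⟩
  (k + 1) * cliqueCount (adj G) vs k
    ∎
  where
  open BarGraph G N X
  vs : List (Fin n)
  vs = allFin n
  large-clique⇒core : ∀ s → length s ≡ k → pairwiseAdj (barAdj G N X) s ≡ true → allB isCore s ≡ true
  large-clique⇒core s refl = allB-large-clique barAdj-sym triangle⇒isCore s 3≤k
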